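{- Let $\sigma\geq 2$ and $k\geq 1$, and let $p_1,p_2,\ldots,p_{\sigma}\in \mathrm{PV}(k,\sigma)$ be pairwise distinct. Let $q=\wedge(p_1,\ldots,p_\sigma)$ and $r=\vee(p_1,\ldots,p_\sigma)$. If for all $i\neq j$, $p_i$ is a neighbor of $p_j$, then for $\sigma>2$ exactly one of the following two statements holds, while for $\sigma=2$ both hold: (1) for all $i$, $q$ is a child of $p_i$; (2) for all $i$, $r$ is a parent of $p_i$. Conversely, for any $\sigma\ge 2$, if $q$ is a child of every $p_i$, or if $r$ is a parent of every $p_i$, then the $p_i$ are pairwise neighbors.
   Context: A Parikh vector over an alphabet of size $\sigma$ is a vector in $\mathbb{N}^\sigma$ (non-negative integer entries); its order is the sum of its entries. $\mathrm{PV}(k,\sigma)$ denotes the set of Parikh vectors of order $k$. $e_i$ is the $i$-th unit vector. Two Parikh vectors $p,p'$ of the same order are neighbors if there exist $i\neq j$ with $p'=p-e_i+e_j$. A Parikh vector $q$ of order $k-1$ is a child of a Parikh vector $p$ of order $k$ (and $p$ a parent of $q$) if $p=q+e_i$ for some $i$. The meet $\wedge(p_1,\ldots,p_m)$ is the componentwise minimum and the join $\vee(p_1,\ldots,p_m)$ is the componentwise maximum. -}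

module Defs where

open import Data.Nat using (ℕ; zero; suc; _+_; _⊓_; _⊔_)
open import Data.Fin using (Fin; zero; suc)
open import Data.Product using (Σ; ∃; ∃-syntax; _×_)
open import Relation.Binary.PropositionalEquality using (_≡_; _≢_)
open import Relation.Nullary using (yes; no)
open import Data.Fin using (_≟_)

PV : ℕ → Set
PV σ = Fin σ → ℕ

order : ∀ {σ} → PV σ → ℕ
order {zero}  p = 0
order {suc σ} p = p zero + order {σ} (λ l → p (suc l))

e : ∀ {σ} → Fin σ → PV σ
e i l with i ≟ l
... | yes _ = 1
... | no  _ = 0

_+ᵛ_ : ∀ {σ} → PV σ → PV σ → PV σ
(p +ᵛ q) l = p l + q l

_≐_ : ∀ {σ} → PV σ → PV σ → Set
p ≐ q = ∀ l → p l ≡ q l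

-- p' = p - e_i + e_j for some i ≠ j, written without subtraction as
-- p' + e_i = p + e_j (equivalent in ℤ^σ, all vectors being in ℕ^σ).
Neighbor : ∀ {σ} → PV σ → PV σ → Set
Neighbor p p' = ∃[ i ] ∃[ j ] (i ≢ j × ((p' +ᵛ e i) ≐ (p +ᵛ e j)))

Child : ∀ {σ} → PV σ → PV σ → Set
Child q p = ∃[ i ] (p ≐ (q +ᵛ e i))

Parent : ∀ {σ} → PV σ → PV σ → Set
Parent p q = Child q p

meet : ∀ {σ n} → (Fin (suc n) → PV σ) → PV σ
meet {n = zero}  ps l = ps zero l
meet {n = suc n} ps l = ps zero l ⊓ meet {n = n} (λ m → ps (suc m)) l

join : ∀ {σ n} → (Fin (suc n) → PV σ) → PV σ
join {n = zero}  ps l = ps zero l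
join {n = suc n} ps l = ps zero l ⊔ join {n = n} (λ m → ps (suc m)) l

-- Write two neighbours as p₀ = q + e_a and p₁ = q + e_b. Comparing a common
-- neighbour s with q at coordinate a shows that s is either q + e_x (a parent
-- of q) or q + e_a + e_b − e_y (a child of r = q + e_a + e_b). A member of the
-- second kind with y ∉ {a, b} lies strictly above any q + e_x with x ∉ {a, b}
-- at both coordinates a and b, which two neighbours cannot do; so either all
-- members are parents of q = meet or all are children of r = join. If every
-- member were both, pᵢ = q + e_{xᵢ} and r = pⱼ + e_{yⱼ} would force yⱼ = xᵢ for
-- i ≠ j, hence x₀ = y₁ = x₂ and p₀ = p₂.
module Submission where

open import Defs
open import Data.Nat using (ℕ; zero; suc; _+_; _∸_; _≤_; _<_; z≤n; s≤s; _≤?_)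
open import Data.Nat.Properties
  using ( ≤-trans; ≤-antisym; ≤-reflexive; ≤-refl; m⊓n≤m; m⊓n≤n; ⊓-glb; m≤m⊔n; m≤n⊔m; ⊔-lub
        ; m≤m+n; +-identityʳ; +-comm; +-cancelʳ-≡; m∸n+n≡m; <⇒≱; ≰⇒>; <-irrefl; n<1+n
        ; +-commutativeSemigroup; module ≤-Reasoning )
open import Algebra.Properties.CommutativeSemigroup +-commutativeSemigroup using (xy∙z≈xz∙y)
open import Data.Fin using (Fin; zero; suc; _≟_)
open import Data.Product using (∃; ∃-syntax; _×_; _,_; proj₁; proj₂)
open import Data.Sum using (_⊎_; inj₁; inj₂; [_,_]′)
open import Data.Empty using (⊥-elim)
open import Relation.Nullary using (¬_; yes; no)
open import Relation.Binary.PropositionalEquality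

private variable
  σ n : ℕ
  p p′ q q′ s s′ u v : PV σ
  a b i j l x x′ y y′ : Fin σ

Distinct : (Fin n → PV σ) → Set
Distinct ps = ∀ i j → i ≢ j → ¬ (ps i ≐ ps j)

Clique : (Fin n → PV σ) → Set
Clique ps = ∀ i j → i ≢ j → Neighbor (ps i) (ps j)

all⊎any : {A B : Fin n → Set} → (∀ i → A i ⊎ B i) → (∀ i → A i) ⊎ ∃ B
all⊎any {n = zero}  f = inj₁ λ ()
all⊎any {n = suc n} f with f zero | all⊎any (λ i → f (suc i))
... | inj₂ b₀ | _              = inj₂ (zero , b₀)
... | inj₁ _  | inj₂ (i , bᵢ)  = inj₂ (suc i , bᵢ)
... | inj₁ a₀ | inj₁ as        = inj₁ λ { zero → a₀ ; (suc i) → as i }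

e-diag : (i : Fin σ) → e i i ≡ 1
e-diag i with i ≟ i
... | yes _  = refl
... | no i≢i = ⊥-elim (i≢i refl)

e-off : i ≢ l → e i l ≡ 0
e-off {i = i} {l = l} i≢l with i ≟ l
... | yes i≡l = ⊥-elim (i≢l i≡l)
... | no _    = refl

e-nonzero⇒≡ : e i l ≢ 0 → i ≡ l
e-nonzero⇒≡ {i = i} {l = l} eᵢₗ≢0 with i ≟ l
... | yes i≡l = i≡l
... | no _    = ⊥-elim (eᵢₗ≢0 refl)

+ᵛe-diag : (p : PV σ) (i : Fin σ) → (p +ᵛ e i) i ≡ suc (p i)
+ᵛe-diag p i = trans (cong (p i +_) (e-diag i)) (+-comm (p i) 1)

+ᵛe-off : (p : PV σ) → i ≢ l → (p +ᵛ e i) l ≡ p l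
+ᵛe-off {l = l} p i≢l = trans (cong (p l +_) (e-off i≢l)) (+-identityʳ (p l))

≐+ᵛe-diag : p ≐ (q +ᵛ e x) → p x ≡ suc (q x)
≐+ᵛe-diag {q = q} {x = x} p≐ = trans (p≐ x) (+ᵛe-diag q x)

≐+ᵛe-off : p ≐ (q +ᵛ e x) → x ≢ l → p l ≡ q l
≐+ᵛe-off {q = q} {l = l} p≐ x≢l = trans (p≐ l) (+ᵛe-off q x≢l)

≐-sym : p ≐ q → q ≐ p
≐-sym p≐q l = sym (p≐q l)

≐-trans : p ≐ q → q ≐ s → p ≐ s
≐-trans p≐q q≐r l = trans (p≐q l) (q≐r l)

+ᵛ-congʳ : (u : PV σ) → p ≐ q → (p +ᵛ u) ≐ (q +ᵛ u)
+ᵛ-congʳ u p≐q l = cong (_+ u l) (p≐q l)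

+ᵛ-cancelʳ : (u : PV σ) → (p +ᵛ u) ≐ (q +ᵛ u) → p ≐ q
+ᵛ-cancelʳ u h l = +-cancelʳ-≡ (u l) _ _ (h l)

+ᵛ-swap : (p u v : PV σ) → ((p +ᵛ u) +ᵛ v) ≐ ((p +ᵛ v) +ᵛ u)
+ᵛ-swap p u v l = xy∙z≈xz∙y (p l) (u l) (v l)

<⇒unit-index≡ : (u +ᵛ e i) ≐ (v +ᵛ e j) → u l < v l → i ≡ l
<⇒unit-index≡ {u = u} {i = i} {v = v} {j = j} {l = l} h uₗ<vₗ = e-nonzero⇒≡ λ eᵢₗ≡0 →
  <⇒≱ uₗ<vₗ (begin
    v l          ≤⟨ m≤m+n (v l) (e j l) ⟩
    v l + e j l  ≡⟨ sym (h l) ⟩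
    u l + e i l  ≡⟨ cong (u l +_) eᵢₗ≡0 ⟩
    u l + 0      ≡⟨ +-identityʳ (u l) ⟩
    u l          ∎)
  where open ≤-Reasoning

below-at-two⇒¬Neighbor : a ≢ b → s a < s′ a → s b < s′ b → ¬ Neighbor s′ s
below-at-two⇒¬Neighbor {s = s} {s′ = s′} a≢b sₐ<s′ₐ s_b<s′_b (i , j , _ , H) =
  a≢b (trans (sym (index≡ sₐ<s′ₐ)) (index≡ s_b<s′_b))
  where
  index≡ : ∀ {l} → s l < s′ l → i ≡ l
  index≡ = <⇒unit-index≡ {u = s} {i = i} {v = s′} {j = j} H

same-child-index⇒≐ : p ≐ (q +ᵛ e x) → p′ ≐ (q +ᵛ e x′) → x ≡ x′ → p ≐ p′
same-child-index⇒≐ p≐ p′≐ refl = ≐-trans p≐ (≐-sym p′≐)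

Child-resp-≐ : q ≐ q′ → Child q p → Child q′ p
Child-resp-≐ q≐q′ (x , p≐) = x , ≐-trans p≐ (+ᵛ-congʳ (e x) q≐q′)

Parent-resp-≐ : {r r′ : PV σ} → r ≐ r′ → Parent r p → Parent r′ p
Parent-resp-≐ r≐r′ (y , r≐) = y , ≐-trans (≐-sym r≐r′) r≐

common-child⇒Neighbor : Child q p → Child q p′ → ¬ (p ≐ p′) → Neighbor p p′
common-child⇒Neighbor {q = q} (x , p≐) (x′ , p′≐) p≉p′ =
  x , x′ , x≢x′ ,
  ≐-trans (+ᵛ-congʳ (e x) p′≐) (≐-trans (+ᵛ-swap q (e x′) (e x)) (+ᵛ-congʳ (e x′) (≐-sym p≐)))
  where
  x≢x′ : x ≢ x′
  x≢x′ x≡x′ = p≉p′ (same-child-index⇒≐ p≐ p′≐ x≡x′)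

common-parent⇒Neighbor : {r : PV σ} → Parent r p → Parent r p′ → ¬ (p ≐ p′) → Neighbor p p′
common-parent⇒Neighbor (y , r≐) (y′ , r≐′) p≉p′ = y′ , y , y′≢y , ≐-trans (≐-sym r≐′) r≐
  where
  y′≢y : y′ ≢ y
  y′≢y refl = p≉p′ (+ᵛ-cancelʳ (e y) (≐-trans (≐-sym r≐) r≐′))

Neighbor⇒common-child :
  Neighbor p p′ → ∃[ q ] ∃[ a ] ∃[ b ] (a ≢ b × p ≐ (q +ᵛ e a) × p′ ≐ (q +ᵛ e b))
Neighbor⇒common-child {p = p} {p′ = p′} (a , b , a≢b , H) = q₀ , a , b , a≢b , p≐ , p′≐
  where
  q₀ : PV _
  q₀ l = p l ∸ e a l

  pₐ≡ : p a ≡ suc (p′ a)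
  pₐ≡ = trans (sym (+ᵛe-off p (≢-sym a≢b))) (trans (sym (H a)) (+ᵛe-diag p′ a))

  eₐ≤p : ∀ l → e a l ≤ p l
  eₐ≤p l with a ≟ l
  ... | yes refl = subst (1 ≤_) (sym pₐ≡) (s≤s z≤n)
  ... | no _     = z≤n

  p≐ : p ≐ (q₀ +ᵛ e a)
  p≐ l = sym (m∸n+n≡m (eₐ≤p l))

  p′≐ : p′ ≐ (q₀ +ᵛ e b)
  p′≐ = +ᵛ-cancelʳ (e a) (≐-trans H (≐-trans (+ᵛ-congʳ (e b) p≐) (+ᵛ-swap q₀ (e a) (e b))))

meet-lb : (ps : Fin (suc n) → PV σ) → ∀ i l → meet ps l ≤ ps i l
meet-lb {n = zero}  ps zero    l = ≤-refl
meet-lb {n = suc n} ps zero    l = m⊓n≤m _ _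
meet-lb {n = suc n} ps (suc i) l = ≤-trans (m⊓n≤n _ _) (meet-lb (λ m → ps (suc m)) i l)

meet-glb : (ps : Fin (suc n) → PV σ) → ∀ l {m} → (∀ i → m ≤ ps i l) → m ≤ meet ps l
meet-glb {n = zero}  ps l h = h zero
meet-glb {n = suc n} ps l h = ⊓-glb (h zero) (meet-glb (λ m → ps (suc m)) l (λ i → h (suc i)))

join-ub : (ps : Fin (suc n) → PV σ) → ∀ i l → ps i l ≤ join ps l
join-ub {n = zero}  ps zero    l = ≤-refl
join-ub {n = suc n} ps zero    l = m≤m⊔n _ _
join-ub {n = suc n} ps (suc i) l = ≤-trans (join-ub (λ m → ps (suc m)) i l) (m≤n⊔m _ _)

join-lub : (ps : Fin (suc n) → PV σ) → ∀ l {m} → (∀ i → ps i l ≤ m) → join ps l ≤ m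
join-lub {n = zero}  ps l h = h zero
join-lub {n = suc n} ps l h = ⊔-lub (h zero) (join-lub (λ m → ps (suc m)) l (λ i → h (suc i)))

meet-≐ : (ps : Fin (suc n) → PV σ) →
  (∀ i l → q l ≤ ps i l) → (∀ l → ∃[ i ] (ps i l ≡ q l)) → meet ps ≐ q
meet-≐ ps lower attained l with attained l
... | i , psᵢₗ≡qₗ =
  ≤-antisym (≤-trans (meet-lb ps i l) (≤-reflexive psᵢₗ≡qₗ)) (meet-glb ps l (λ i → lower i l))

join-≐ : {r : PV σ} (ps : Fin (suc n) → PV σ) →
  (∀ i l → ps i l ≤ r l) → (∀ l → ∃[ i ] (ps i l ≡ r l)) → join ps ≐ r
join-≐ ps upper attained l with attained l
... | i , psᵢₗ≡rₗ =
  ≤-antisym (join-lub ps l (λ i → upper i l)) (≤-trans (≤-reflexive (sym psᵢₗ≡rₗ)) (join-ub ps i l))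

module Edge {σ} (q : PV σ) {a b : Fin σ} (a≢b : a ≢ b) where

  b≢a : b ≢ a
  b≢a = ≢-sym a≢b

  r : PV σ
  r = (q +ᵛ e a) +ᵛ e b

  common-neighbor : p ≐ (q +ᵛ e a) → p′ ≐ (q +ᵛ e b) →
    Neighbor p s → Neighbor p′ s → Child q s ⊎ Parent r s
  common-neighbor {p = p} {p′ = p′} {s = s} p≐ p′≐ (c , d , _ , H) (c′ , d′ , _ , H′)
    with s a ≤? q a
  ... | yes sₐ≤qₐ
    with refl ← <⇒unit-index≡ {i = c} {j = d} {l = a} H
                  (subst (s a <_) (sym (≐+ᵛe-diag p≐)) (s≤s sₐ≤qₐ)) =
    inj₁ (d , +ᵛ-cancelʳ (e a) (≐-trans H (≐-trans (+ᵛ-congʳ (e d) p≐) (+ᵛ-swap q (e a) (e d)))))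
  ... | no sₐ≰qₐ
    with refl ← <⇒unit-index≡ {i = d′} {j = c′} {l = a} (≐-sym H′)
                  (subst (_< s a) (sym (≐+ᵛe-off p′≐ b≢a)) (≰⇒> sₐ≰qₐ)) =
    inj₂ (c′ , ≐-trans (+ᵛ-swap q (e a) (e b)) (≐-trans (+ᵛ-congʳ (e a) (≐-sym p′≐)) (≐-sym H′)))

  OutsideParent : PV σ → Set
  OutsideParent s = ∃[ y ] (y ≢ a × y ≢ b × r ≐ (s +ᵛ e y))

  Parent⇒Child⊎OutsideParent : Parent r s → Child q s ⊎ OutsideParent s
  Parent⇒Child⊎OutsideParent (y , r≐) with y ≟ a | y ≟ b
  ... | yes refl | _        = inj₁ (b , +ᵛ-cancelʳ (e y) (≐-trans (≐-sym r≐) (+ᵛ-swap q (e y) (e b))))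
  ... | no _     | yes refl = inj₁ (a , +ᵛ-cancelʳ (e y) (≐-sym r≐))
  ... | no y≢a   | no y≢b   = inj₂ (y , y≢a , y≢b , r≐)

  outside-child-below-outside-parent : OutsideParent s′ → s ≐ (q +ᵛ e x) → x ≢ a → x ≢ b →
    s a < s′ a × s b < s′ b
  outside-child-below-outside-parent {s′ = s′} {s = s} (y , y≢a , y≢b , r≐) s≐ x≢a x≢b =
      subst₂ _<_ (sym (≐+ᵛe-off s≐ x≢a)) (sym s′ₐ≡) (n<1+n (q a))
    , subst₂ _<_ (sym (≐+ᵛe-off s≐ x≢b)) (sym s′_b≡) (n<1+n (q b))
    where
    s′ₐ≡ : s′ a ≡ suc (q a)
    s′ₐ≡ = trans (sym (+ᵛe-off s′ y≢a))
             (trans (sym (r≐ a)) (trans (+ᵛe-off (q +ᵛ e a) b≢a) (+ᵛe-diag q a)))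
    s′_b≡ : s′ b ≡ suc (q b)
    s′_b≡ = trans (sym (+ᵛe-off s′ y≢b))
              (trans (sym (r≐ b)) (trans (+ᵛe-diag (q +ᵛ e a) b) (cong suc (+ᵛe-off q a≢b))))

  module _ {n} (ps : Fin (suc (suc n)) → PV σ)
           (ps₀≐ : ps zero ≐ (q +ᵛ e a)) (ps₁≐ : ps (suc zero) ≐ (q +ᵛ e b)) where

    r≐ps₀ : r ≐ (ps zero +ᵛ e b)
    r≐ps₀ = ≐-sym (+ᵛ-congʳ (e b) ps₀≐)

    r≐ps₁ : r ≐ (ps (suc zero) +ᵛ e a)
    r≐ps₁ = ≐-trans (+ᵛ-swap q (e a) (e b)) (≐-sym (+ᵛ-congʳ (e a) ps₁≐))

    children⇒meet-children : (∀ m → Child q (ps m)) → ∀ m → Child (meet ps) (ps m)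
    children⇒meet-children children m = Child-resp-≐ (≐-sym meet≐q) (children m)
      where
      lower : ∀ i l → q l ≤ ps i l
      lower i l with children i
      ... | x , X = ≤-trans (m≤m+n (q l) (e x l)) (≤-reflexive (sym (X l)))
      attained : ∀ l → ∃[ i ] (ps i l ≡ q l)
      attained l with a ≟ l
      ... | yes refl = suc zero , ≐+ᵛe-off ps₁≐ b≢a
      ... | no a≢l   = zero , ≐+ᵛe-off ps₀≐ a≢l
      meet≐q : meet ps ≐ q
      meet≐q = meet-≐ ps lower attained

    parents⇒join-parents : (∀ m → Parent r (ps m)) → ∀ m → Parent (join ps) (ps m)
    parents⇒join-parents parents m = Parent-resp-≐ (≐-sym join≐r) (parents m)
      where
      upper : ∀ i l → ps i l ≤ r l
      upper i l with parents i
      ... | y , Y = ≤-trans (m≤m+n (ps i l) (e y l)) (≤-reflexive (sym (Y l)))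
      attained : ∀ l → ∃[ i ] (ps i l ≡ r l)
      attained l with l ≟ b
      ... | yes refl = suc zero , trans (sym (+ᵛe-off (ps (suc zero)) a≢b)) (sym (r≐ps₁ b))
      ... | no l≢b   = zero , trans (sym (+ᵛe-off (ps zero) (≢-sym l≢b))) (sym (r≐ps₀ l))
      join≐r : join ps ≐ r
      join≐r = join-≐ ps upper attained

    module _ (clique : Clique ps) where

      child⊎parent : ∀ m → Child q (ps m) ⊎ Parent r (ps m)
      child⊎parent zero          = inj₁ (a , ps₀≐)
      child⊎parent (suc zero)    = inj₁ (b , ps₁≐)
      child⊎parent (suc (suc m)) =
        common-neighbor ps₀≐ ps₁≐ (clique zero (suc (suc m)) λ ()) (clique (suc zero) (suc (suc m)) λ ())

      outside-parent⇒parents : ∃[ m′ ] OutsideParent (ps m′) → ∀ m → Parent r (ps m)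
      outside-parent⇒parents (m′ , outside) m with child⊎parent m
      ... | inj₂ parent  = parent
      ... | inj₁ (x , X) with x ≟ a | x ≟ b
      ... | yes refl | _        = b , ≐-sym (+ᵛ-congʳ (e b) X)
      ... | no _     | yes refl = a , ≐-trans (+ᵛ-swap q (e a) (e b)) (≐-sym (+ᵛ-congʳ (e a) X))
      ... | no x≢a   | no x≢b   with outside-child-below-outside-parent outside X x≢a x≢b | m ≟ m′
      ...   | below , _ | yes refl = ⊥-elim (<-irrefl refl below)
      ...   | belowₐ , below_b | no m≢m′ =
        ⊥-elim (below-at-two⇒¬Neighbor a≢b belowₐ below_b (clique m′ m (≢-sym m≢m′)))

      meet-children⊎join-parents :
        (∀ m → Child (meet ps) (ps m)) ⊎ (∀ m → Parent (join ps) (ps m))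
      meet-children⊎join-parents
        with all⊎any (λ m → [ inj₁ , Parent⇒Child⊎OutsideParent ]′ (child⊎parent m))
      ... | inj₁ children = inj₁ (children⇒meet-children children)
      ... | inj₂ outside  = inj₂ (parents⇒join-parents (outside-parent⇒parents outside))

clique⇒meet-children⊎join-parents : (ps : Fin (suc (suc n)) → PV σ) → Clique ps →
  (∀ m → Child (meet ps) (ps m)) ⊎ (∀ m → Parent (join ps) (ps m))
clique⇒meet-children⊎join-parents ps clique with Neighbor⇒common-child (clique zero (suc zero) λ ())
... | q , a , b , a≢b , ps₀≐ , ps₁≐ = Edge.meet-children⊎join-parents q a≢b ps ps₀≐ ps₁≐ clique

pair⇒meet-children×join-parents : (ps : Fin (suc n) → PV σ) → suc n ≡ 2 → Clique ps →
  (∀ m → Child (meet ps) (ps m)) × (∀ m → Parent (join ps) (ps m))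
pair⇒meet-children×join-parents ps refl clique with Neighbor⇒common-child (clique zero (suc zero) λ ())
... | q , a , b , a≢b , ps₀≐ , ps₁≐ =
  children⇒meet-children ps ps₀≐ ps₁≐ children , parents⇒join-parents ps ps₀≐ ps₁≐ parents
  where
  open Edge q a≢b using (r; children⇒meet-children; parents⇒join-parents; r≐ps₀; r≐ps₁)

  children : ∀ m → Child q (ps m)
  children zero       = a , ps₀≐
  children (suc zero) = b , ps₁≐

  parents : ∀ m → Parent r (ps m)
  parents zero       = b , r≐ps₀ ps ps₀≐ ps₁≐
  parents (suc zero) = a , r≐ps₁ ps ps₀≐ ps₁≐

sibling-parent-index : {r : PV σ} → p ≐ (q +ᵛ e x) → p′ ≐ (q +ᵛ e x′) →
  r ≐ (p +ᵛ e y) → r ≐ (p′ +ᵛ e y′) → ¬ (p ≐ p′) → y′ ≡ x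
sibling-parent-index {p = p} {q = q} {x = x} {p′ = p′} {x′ = x′} {y = y} {y′ = y′} p≐ p′≐ r≐ r≐′ p≉p′ =
  <⇒unit-index≡ {u = p′} {i = y′} {v = p} {j = y} (≐-trans (≐-sym r≐′) r≐) p′ₓ<pₓ
  where
  x′≢x : x′ ≢ x
  x′≢x x′≡x = p≉p′ (same-child-index⇒≐ p≐ p′≐ (sym x′≡x))
  p′ₓ<pₓ : p′ x < p x
  p′ₓ<pₓ = subst₂ _<_ (sym (≐+ᵛe-off p′≐ x′≢x)) (sym (≐+ᵛe-diag p≐)) (n<1+n (q x))

¬children×parents : {r : PV σ} (ps : Fin (suc n) → PV σ) → 2 < suc n → Distinct ps →
  ¬ ((∀ i → Child q (ps i)) × (∀ i → Parent r (ps i)))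
¬children×parents ps (s≤s (s≤s (s≤s _))) distinct (children , parents) =
  distinct zero two (λ ()) (same-child-index⇒≐ (proj₂ (children zero)) (proj₂ (children two)) x₀≡x₂)
  where
  two : Fin _
  two = suc (suc zero)
  y₁≡x : ∀ i → i ≢ suc zero → proj₁ (parents (suc zero)) ≡ proj₁ (children i)
  y₁≡x i i≢1 = sibling-parent-index (proj₂ (children i)) (proj₂ (children (suc zero)))
    (proj₂ (parents i)) (proj₂ (parents (suc zero))) (distinct i (suc zero) i≢1)
  x₀≡x₂ : proj₁ (children zero) ≡ proj₁ (children two)
  x₀≡x₂ = trans (sym (y₁≡x zero λ ())) (y₁≡x two λ ())

children⊎parents⇒clique : {r : PV σ} {ps : Fin n → PV σ} → Distinct ps →
  (∀ i → Child q (ps i)) ⊎ (∀ i → Parent r (ps i)) → Clique ps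
children⊎parents⇒clique distinct (inj₁ children) i j i≢j =
  common-child⇒Neighbor (children i) (children j) (distinct i j i≢j)
children⊎parents⇒clique distinct (inj₂ parents) i j i≢j =
  common-parent⇒Neighbor (parents i) (parents j) (distinct i j i≢j)

-- Neighbours automatically have equal order.
lemma1 : (n k : ℕ) → let σ = suc n in 2 ≤ σ → 1 ≤ k →
    (ps : Fin σ → PV σ) →
    (∀ i → order (ps i) ≡ k) →
    (∀ i j → i ≢ j → ¬ (ps i ≐ ps j)) →
    ((∀ i j → i ≢ j → Neighbor (ps i) (ps j)) →
      ((2 < σ →
          (((∀ i → Child (meet ps) (ps i)) ⊎ (∀ i → Parent (join ps) (ps i)))
           × ¬ ((∀ i → Child (meet ps) (ps i)) × (∀ i → Parent (join ps) (ps i)))))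
       × (σ ≡ 2 →
          ((∀ i → Child (meet ps) (ps i)) × (∀ i → Parent (join ps) (ps i))))))
    × (((∀ i → Child (meet ps) (ps i)) ⊎ (∀ i → Parent (join ps) (ps i))) →
       ∀ i j → i ≢ j → Neighbor (ps i) (ps j))
lemma1 (suc n) _ (s≤s (s≤s z≤n)) _ ps _ distinct =
    (λ clique →
        (λ 2<σ → clique⇒meet-children⊎join-parents ps clique , ¬children×parents ps 2<σ distinct)
      , (λ σ≡2 → pair⇒meet-children×join-parents ps σ≡2 clique))
  , children⊎parents⇒clique distinct
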